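{- For every integer $m\ge 0$ and $n=6m+3$, there is a transversal design on $n$ points with three groups (each of size $2m+1$) that contains neither $F^3$ nor the Pasch configuration $P$ as a subconfiguration.
   Context: A transversal design with three groups is a triple system whose point set is partitioned into three groups of equal size such that every triple has one point in each group and each pair of points from different groups lies in exactly one triple. $F^3$ is the configuration with triples $\{1,2,3\},\{3,4,5\},\{1,5,6\},\{3,6,7\}$; the Pasch configuration $P$ has triples $\{1,2,3\},\{3,4,5\},\{1,5,6\},\{2,4,6\}$. Containment means some set of triples forms an isomorphic copy (not necessarily induced). -}

module Defs where

open import Data.Nat using (ℕ)
open import Data.Fin using (Fin; zero; suc)
open import Data.Fin.Subset using (Subset; _∈_; ∣_∣; ⁅_⁆; _∪_)
open import Data.Fin.Properties using () renaming (_≟_ to _≟ᶠ_)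
open import Data.Vec using (Vec; tabulate; []; _∷_)
open import Data.Product using (Σ; ∃; _×_; _,_)
open import Data.List using (List; []; _∷_)
open import Data.List.Relation.Unary.All using (All)
open import Relation.Binary.PropositionalEquality using (_≡_; _≢_)
open import Relation.Nullary using (¬_)
open import Relation.Nullary.Decidable using (⌊_⌋)
open import Function.Definitions using (Injective)

record TripleSystem (n : ℕ) : Set₁ where
  field
    Block    : Subset n → Set
    block-3  : ∀ B → Block B → ∣ B ∣ ≡ 3

open TripleSystem public

-- The group (part of the partition into 3 groups) containing a point is
-- given by a map  group : Fin n → Fin 3.
groupMembers : ∀ {n} → (Fin n → Fin 3) → Fin 3 → Subset n
groupMembers g i = tabulate (λ x → ⌊ g x ≟ᶠ i ⌋)

record IsTD3 {n : ℕ} (T : TripleSystem n) (group : Fin n → Fin 3) (k : ℕ) : Set where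
  field
    group-size : ∀ i → ∣ groupMembers group i ∣ ≡ k
    transversal : ∀ B → Block T B → ∀ x y → x ∈ B → y ∈ B → x ≢ y → group x ≢ group y
    pair-covered : ∀ x y → group x ≢ group y →
                   Σ (Subset n) λ B → (Block T B × x ∈ B × y ∈ B) ×
                     (∀ B' → Block T B' → x ∈ B' → y ∈ B' → B' ≡ B)

Configuration : ℕ → Set
Configuration k = List (Fin k × Fin k × Fin k)

tripleSet : ∀ {n} → Fin n × Fin n × Fin n → Subset n
tripleSet (a , b , c) = ⁅ a ⁆ ∪ ⁅ b ⁆ ∪ ⁅ c ⁆

-- T contains the configuration C (not necessarily induced): there is an
-- injective map of the points of C into the points of T sending every triple
-- of C to a block of T.
Contains : ∀ {n k} → TripleSystem n → Configuration k → Set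
Contains {n} {k} T C =
  Σ (Fin k → Fin n) λ f → Injective _≡_ _≡_ f ×
    All (λ { (a , b , c) → Block T (tripleSet (f a , f b , f c)) }) C

-- Points 1..7 are represented by Fin 7 elements 0..6.
p1 p2 p3 p4 p5 p6 p7 : Fin 7
p1 = zero
p2 = suc zero
p3 = suc (suc zero)
p4 = suc (suc (suc zero))
p5 = suc (suc (suc (suc zero)))
p6 = suc (suc (suc (suc (suc zero))))
p7 = suc (suc (suc (suc (suc (suc zero)))))

F3 : Configuration 7
F3 = (p1 , p2 , p3) ∷ (p3 , p4 , p5) ∷ (p1 , p5 , p6) ∷ (p3 , p6 , p7) ∷ []

q1 q2 q3 q4 q5 q6 : Fin 6
q1 = zero
q2 = suc zero
q3 = suc (suc zero)
q4 = suc (suc (suc zero))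
q5 = suc (suc (suc (suc zero)))
q6 = suc (suc (suc (suc (suc zero))))

Pasch : Configuration 6
Pasch = (q1 , q2 , q3) ∷ (q3 , q4 , q5) ∷ (q1 , q5 , q6) ∷ (q2 , q4 , q6) ∷ []

module Submission where

-- The points are the pairs (i , a)
-- with i : Fin 3 (the group) and a ∈ ℤ/K (the position); the blocks are the
-- "zero-sum sections"  {(0 , v 0) , (1 , v 1) , (2 , v 2)}  with
-- v 0 + v 1 + v 2 ≡ 0 (mod K).  Any two coordinates of a section determine
-- the third, which gives the transversal-design axioms.
--
-- Why the configurations are absent.
--  * F³ needs four pairwise "collinear" points 1, 5, 6 and 3 lying in four
--    different groups, impossible with three groups: no TD with three groups
--    contains F³ (a fact about every such design, proved first).
--  * In any TD with three groups, a Pasch configuration has points 2 and 5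
--    in the same group.  In the cyclic design, adding up the four block
--    equations gives 2·(pos 2) ≡ 2·(pos 5) (mod K), and K is odd, so the
--    points 2 and 5 coincide, contradicting injectivity.

open import Data.Bool using (Bool; true; false)
open import Data.Empty using (⊥-elim)
open import Data.Fin using (Fin; zero; suc; toℕ; fromℕ<; _↑ˡ_; _↑ʳ_; quotient; remainder; combine)
open import Data.Fin.Properties using (toℕ<n; toℕ-injective; toℕ-fromℕ<; splitAt-↑ˡ; splitAt-↑ʳ; remQuot-combine; combine-remQuot; all?) renaming (_≟_ to _≟ᶠ_)
open import Data.Fin.Subset using (Subset; _∈_; _∉_; ∣_∣; ⁅_⁆; _∪_; inside; outside)
open import Data.Fin.Subset.Properties using (∪-identityˡ; ∣⁅x⁆∣≡1; x∈⁅x⁆; x∈⁅y⁆⇒x≡y; x∈p∪q⁺; x∈p∪q⁻)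
open import Data.List using ([]; _∷_)
open import Data.List.Relation.Unary.All using ([]; _∷_)
open import Data.Nat using (ℕ; zero; suc; _+_; _*_)
open import Data.Nat.DivMod using (_%_; %-distribˡ-+; %-distribˡ-*; [m+kn]%n≡m%n; m%n%n≡m%n; m%n<n; m*n%n≡0; m<n⇒m%n≡m)
open import Data.Nat.Properties using (+-comm; +-identityʳ; *-comm)
open import Data.Nat.Solver using (module +-*-Solver)
open +-*-Solver using (solve; _:+_; _:*_; _:=_; con)
open import Data.Product using (Σ; _×_; _,_; proj₁; proj₂)
open import Data.Sum using (_⊎_; inj₁; inj₂)
open import Data.Vec using (tabulate; _∷_)
open import Data.Vec.Base using (here; there)
open import Data.Vec.Properties using (tabulate-cong)
open import Function using (_∘_)
open import Function.Definitions using (Injective)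
open import Level using (0ℓ)
open import Relation.Binary.Bundles using (Setoid)
open import Relation.Binary.PropositionalEquality
import Relation.Binary.Reasoning.Setoid as SetoidReasoning
open import Relation.Nullary using (¬_; yes; no)
open import Relation.Nullary.Decidable using (⌊_⌋; toWitness; ¬?; _×-dec_; _→-dec_)

open import Defs

Distinct3 : {A : Set} → A → A → A → Set
Distinct3 a b c = a ≢ b × a ≢ c × b ≢ c

-- For distinct i and j, the remaining element of Fin 3 (its value on the
-- diagonal is irrelevant).
other : Fin 3 → Fin 3 → Fin 3
other zero             (suc zero)       = suc (suc zero)
other zero             (suc (suc zero)) = suc zero
other (suc zero)       zero             = suc (suc zero)
other (suc zero)       (suc (suc zero)) = zero
other (suc (suc zero)) zero             = suc zero
other (suc (suc zero)) (suc zero)       = zero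
other _                _                = zero

-- Anything distinct from two distinct elements of Fin 3 is the remaining
-- one: the pigeonhole fact behind both configuration arguments.
only-other : ∀ {i j x : Fin 3} → Distinct3 i j x → x ≡ other i j
only-other {i} {j} {x} (i≢j , i≢x , j≢x) = toWitness {a? = check} _ i j x i≢j i≢x j≢x
  where
  check = all? λ i → all? λ j → all? λ x →
    ¬? (i ≟ᶠ j) →-dec ¬? (i ≟ᶠ x) →-dec ¬? (j ≟ᶠ x) →-dec (x ≟ᶠ other i j)

other-distinct : ∀ {i j : Fin 3} → i ≢ j → Distinct3 i j (other i j)
other-distinct {i} {j} i≢j = toWitness {a? = check} _ i j i≢j
  where
  check = all? λ i → all? λ j →
    ¬? (i ≟ᶠ j) →-dec (¬? (i ≟ᶠ j) ×-dec ¬? (i ≟ᶠ other i j) ×-dec ¬? (j ≟ᶠ other i j))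

Σ3 : (Fin 3 → ℕ) → ℕ
Σ3 F = F zero + F (suc zero) + F (suc (suc zero))

sum-other : (F : Fin 3 → ℕ) (i j : Fin 3) → i ≢ j → F i + F j + F (other i j) ≡ Σ3 F
sum-other F zero             zero             i≢j = ⊥-elim (i≢j refl)
sum-other F (suc zero)       (suc zero)       i≢j = ⊥-elim (i≢j refl)
sum-other F (suc (suc zero)) (suc (suc zero)) i≢j = ⊥-elim (i≢j refl)
sum-other F zero             (suc zero)       _   = refl
sum-other F zero             (suc (suc zero)) _   =
  solve 3 (λ a b c → a :+ c :+ b := a :+ b :+ c) refl (F zero) (F (suc zero)) (F (suc (suc zero)))
sum-other F (suc zero)       zero             _   =
  solve 3 (λ a b c → b :+ a :+ c := a :+ b :+ c) refl (F zero) (F (suc zero)) (F (suc (suc zero)))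
sum-other F (suc zero)       (suc (suc zero)) _   =
  solve 3 (λ a b c → b :+ c :+ a := a :+ b :+ c) refl (F zero) (F (suc zero)) (F (suc (suc zero)))
sum-other F (suc (suc zero)) zero             _   =
  solve 3 (λ a b c → c :+ a :+ b := a :+ b :+ c) refl (F zero) (F (suc zero)) (F (suc (suc zero)))
sum-other F (suc (suc zero)) (suc zero)       _   =
  solve 3 (λ a b c → c :+ b :+ a := a :+ b :+ c) refl (F zero) (F (suc zero)) (F (suc (suc zero)))

sum-distinct : (F : Fin 3 → ℕ) {i j l : Fin 3} → Distinct3 i j l → F i + F j + F l ≡ Σ3 F
sum-distinct F {i} {j} d@(i≢j , _ , _) rewrite only-other d = sum-other F i j i≢j

module _ {n : ℕ} where

  ∈-tripleSet⁻ : ∀ {x} (p q r : Fin n) → x ∈ tripleSet (p , q , r) → x ≡ p ⊎ x ≡ q ⊎ x ≡ r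
  ∈-tripleSet⁻ p q r x∈ with x∈p∪q⁻ ⁅ p ⁆ (⁅ q ⁆ ∪ ⁅ r ⁆) x∈
  ... | inj₁ x∈p = inj₁ (x∈⁅y⁆⇒x≡y p x∈p)
  ... | inj₂ x∈qr with x∈p∪q⁻ ⁅ q ⁆ ⁅ r ⁆ x∈qr
  ...   | inj₁ x∈q = inj₂ (inj₁ (x∈⁅y⁆⇒x≡y q x∈q))
  ...   | inj₂ x∈r = inj₂ (inj₂ (x∈⁅y⁆⇒x≡y r x∈r))

  ∈-triple₁ : ∀ (p q r : Fin n) → p ∈ tripleSet (p , q , r)
  ∈-triple₁ p q r = x∈p∪q⁺ (inj₁ (x∈⁅x⁆ p))

  ∈-triple₂ : ∀ (p q r : Fin n) → q ∈ tripleSet (p , q , r)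
  ∈-triple₂ p q r = x∈p∪q⁺ {p = ⁅ p ⁆} (inj₂ (x∈p∪q⁺ (inj₁ (x∈⁅x⁆ q))))

  ∈-triple₃ : ∀ (p q r : Fin n) → r ∈ tripleSet (p , q , r)
  ∈-triple₃ p q r = x∈p∪q⁺ {p = ⁅ p ⁆} (inj₂ (x∈p∪q⁺ {p = ⁅ q ⁆} (inj₂ (x∈⁅x⁆ r))))

∣⁅x⁆∪p∣ : ∀ {n} (x : Fin n) (p : Subset n) → x ∉ p → ∣ ⁅ x ⁆ ∪ p ∣ ≡ suc ∣ p ∣
∣⁅x⁆∪p∣ zero    (inside  ∷ p) x∉p = ⊥-elim (x∉p here)
∣⁅x⁆∪p∣ zero    (outside ∷ p) _   = cong suc (cong ∣_∣ (∪-identityˡ p))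
∣⁅x⁆∪p∣ (suc x) (inside  ∷ p) x∉p = cong suc (∣⁅x⁆∪p∣ x p (x∉p ∘ there))
∣⁅x⁆∪p∣ (suc x) (outside ∷ p) x∉p = ∣⁅x⁆∪p∣ x p (x∉p ∘ there)

∣tripleSet∣ : ∀ {n} {p q r : Fin n} → Distinct3 p q r → ∣ tripleSet (p , q , r) ∣ ≡ 3
∣tripleSet∣ {p = p} {q} {r} (p≢q , p≢r , q≢r) = begin
  ∣ ⁅ p ⁆ ∪ (⁅ q ⁆ ∪ ⁅ r ⁆) ∣   ≡⟨ ∣⁅x⁆∪p∣ p _ p∉qr ⟩
  suc ∣ ⁅ q ⁆ ∪ ⁅ r ⁆ ∣         ≡⟨ cong suc (∣⁅x⁆∪p∣ q _ (q≢r ∘ x∈⁅y⁆⇒x≡y r)) ⟩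
  suc (suc ∣ ⁅ r ⁆ ∣)           ≡⟨ cong (λ s → 2 + s) (∣⁅x⁆∣≡1 r) ⟩
  3                             ∎
  where
  open ≡-Reasoning
  p∉qr : p ∉ ⁅ q ⁆ ∪ ⁅ r ⁆
  p∉qr p∈ with x∈p∪q⁻ ⁅ q ⁆ ⁅ r ⁆ p∈
  ... | inj₁ p∈q = p≢q (x∈⁅y⁆⇒x≡y q p∈q)
  ... | inj₂ p∈r = p≢r (x∈⁅y⁆⇒x≡y r p∈r)

map-distinct : ∀ {A B : Set} {f : A → B} → Injective _≡_ _≡_ f →
               ∀ {a b c} → Distinct3 a b c → Distinct3 (f a) (f b) (f c)
map-distinct f-inj (a≢b , a≢c , b≢c) = a≢b ∘ f-inj , a≢c ∘ f-inj , b≢c ∘ f-inj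

module TD3Facts {n k : ℕ} {T : TripleSystem n} {group : Fin n → Fin 3}
                (td : IsTD3 T group k) where

  open IsTD3 td using (transversal)

  block-groups : ∀ {x y z} → Block T (tripleSet (x , y , z)) → Distinct3 x y z →
                 Distinct3 (group x) (group y) (group z)
  block-groups {x} {y} {z} B (x≢y , x≢z , y≢z) =
      transversal _ B x y (∈-triple₁ x y z) (∈-triple₂ x y z) x≢y
    , transversal _ B x z (∈-triple₁ x y z) (∈-triple₃ x y z) x≢z
    , transversal _ B y z (∈-triple₂ x y z) (∈-triple₃ x y z) y≢z

  embedded-groups : ∀ {c} {f : Fin c → Fin n} → Injective _≡_ _≡_ f → ∀ {a b d} →
                    Block T (tripleSet (f a , f b , f d)) → Distinct3 a b d →
                    Distinct3 (group (f a)) (group (f b)) (group (f d))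
  embedded-groups f-inj B d = block-groups B (map-distinct f-inj d)

  -- F³ would need the points 3, 1, 5, 6 in four different groups.
  F3-free : ¬ Contains T F3
  F3-free (f , f-inj , B₁ ∷ B₂ ∷ B₃ ∷ B₄ ∷ []) = g₅≢g₆ (trans g₅≡ (sym g₆≡))
    where
    g : Fin 7 → Fin 3
    g = group ∘ f
    d₁ = embedded-groups f-inj B₁ ((λ ()) , (λ ()) , (λ ()))
    d₂ = embedded-groups f-inj B₂ ((λ ()) , (λ ()) , (λ ()))
    d₃ = embedded-groups f-inj B₃ ((λ ()) , (λ ()) , (λ ()))
    d₄ = embedded-groups f-inj B₄ ((λ ()) , (λ ()) , (λ ()))
    g₃≢g₁ : g p3 ≢ g p1
    g₃≢g₁ = ≢-sym (proj₁ (proj₂ d₁))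
    g₅≡ : g p5 ≡ other (g p3) (g p1)
    g₅≡ = only-other (g₃≢g₁ , proj₁ (proj₂ d₂) , proj₁ d₃)
    g₆≡ : g p6 ≡ other (g p3) (g p1)
    g₆≡ = only-other (g₃≢g₁ , proj₁ d₄ , proj₁ (proj₂ d₃))
    g₅≢g₆ : g p5 ≢ g p6
    g₅≢g₆ = proj₂ (proj₂ d₃)

  -- In a Pasch configuration the points 2 and 5 are both in the group
  -- missed by 1 and 3 (only the first three blocks are needed).
  pasch-same-group : ∀ {f : Fin 6 → Fin n} → Injective _≡_ _≡_ f →
    Block T (tripleSet (f q1 , f q2 , f q3)) → Block T (tripleSet (f q3 , f q4 , f q5)) →
    Block T (tripleSet (f q1 , f q5 , f q6)) → group (f q2) ≡ group (f q5)
  pasch-same-group {f} f-inj B₁ B₂ B₃ = trans g₂≡ (sym g₅≡)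
    where
    g : Fin 6 → Fin 3
    g = group ∘ f
    d₁ = embedded-groups f-inj B₁ ((λ ()) , (λ ()) , (λ ()))
    d₂ = embedded-groups f-inj B₂ ((λ ()) , (λ ()) , (λ ()))
    d₃ = embedded-groups f-inj B₃ ((λ ()) , (λ ()) , (λ ()))
    g₂≡ : g q2 ≡ other (g q1) (g q3)
    g₂≡ = only-other (proj₁ (proj₂ d₁) , proj₁ d₁ , ≢-sym (proj₂ (proj₂ d₁)))
    g₅≡ : g q5 ≡ other (g q1) (g q3)
    g₅≡ = only-other (proj₁ (proj₂ d₁) , proj₁ d₃ , proj₁ (proj₂ d₂))

∣tabulate∣-+ : ∀ a {b} (f : Fin (a + b) → Bool) →
               ∣ tabulate f ∣ ≡ ∣ tabulate (f ∘ (_↑ˡ b)) ∣ + ∣ tabulate (f ∘ (a ↑ʳ_)) ∣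
∣tabulate∣-+ zero    f = refl
∣tabulate∣-+ (suc a) f with f zero
... | true  = cong suc (∣tabulate∣-+ a (f ∘ suc))
... | false = ∣tabulate∣-+ a (f ∘ suc)

∣tabulate∣-full : ∀ n {f : Fin n → Bool} → (∀ x → f x ≡ true) → ∣ tabulate f ∣ ≡ n
∣tabulate∣-full zero    _   = refl
∣tabulate∣-full (suc n) all rewrite all zero = cong suc (∣tabulate∣-full n (all ∘ suc))

∣tabulate∣-empty : ∀ n {f : Fin n → Bool} → (∀ x → f x ≡ false) → ∣ tabulate f ∣ ≡ 0
∣tabulate∣-empty zero    _    = refl
∣tabulate∣-empty (suc n) none rewrite none zero = ∣tabulate∣-empty n (none ∘ suc)

-- Fin (g * K) is laid out as g consecutive runs of K points, and
-- quotient K tells which run a point belongs to.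
quotient-↑ˡ : ∀ g K (j : Fin K) → quotient {suc g} K (j ↑ˡ (g * K)) ≡ zero
quotient-↑ˡ g K j rewrite splitAt-↑ˡ K j (g * K) = refl

quotient-↑ʳ : ∀ g K (j : Fin (g * K)) → quotient {suc g} K (K ↑ʳ j) ≡ suc (quotient {g} K j)
quotient-↑ʳ g K j rewrite splitAt-↑ʳ K (g * K) j = refl

⌊suc≟suc⌋ : ∀ {n} (a b : Fin n) → ⌊ suc a ≟ᶠ suc b ⌋ ≡ ⌊ a ≟ᶠ b ⌋
⌊suc≟suc⌋ a b with a ≟ᶠ b
... | yes _ = refl
... | no  _ = refl

∣run∣ : ∀ g K (i : Fin g) → ∣ tabulate (λ x → ⌊ quotient {g} K x ≟ᶠ i ⌋) ∣ ≡ K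
∣run∣ (suc g) K zero =
  trans (∣tabulate∣-+ K _) (trans (cong₂ _+_ first rest) (+-identityʳ K))
  where
  first : ∣ tabulate (λ j → ⌊ quotient {suc g} K (j ↑ˡ (g * K)) ≟ᶠ zero ⌋) ∣ ≡ K
  first = ∣tabulate∣-full K (λ j → cong (λ q → ⌊ q ≟ᶠ zero ⌋) (quotient-↑ˡ g K j))
  rest : ∣ tabulate (λ j → ⌊ quotient {suc g} K (K ↑ʳ j) ≟ᶠ zero ⌋) ∣ ≡ 0
  rest = ∣tabulate∣-empty (g * K) (λ j → cong (λ q → ⌊ q ≟ᶠ zero ⌋) (quotient-↑ʳ g K j))
∣run∣ (suc g) K (suc i) =
  trans (∣tabulate∣-+ K _) (cong₂ _+_ first rest)
  where
  first : ∣ tabulate (λ j → ⌊ quotient {suc g} K (j ↑ˡ (g * K)) ≟ᶠ suc i ⌋) ∣ ≡ 0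
  first = ∣tabulate∣-empty K (λ j → cong (λ q → ⌊ q ≟ᶠ suc i ⌋) (quotient-↑ˡ g K j))
  rest : ∣ tabulate (λ j → ⌊ quotient {suc g} K (K ↑ʳ j) ≟ᶠ suc i ⌋) ∣ ≡ K
  rest = trans (cong ∣_∣ (tabulate-cong λ j →
                 trans (cong (λ q → ⌊ q ≟ᶠ suc i ⌋) (quotient-↑ʳ g K j)) (⌊suc≟suc⌋ _ i)))
               (∣run∣ g K i)

module Modular (k : ℕ) where

  K : ℕ
  K = suc k

  -- Congruence modulo K (a record, so that its indices can be inferred).
  infix 4 _≈_
  record _≈_ (x y : ℕ) : Set where
    constructor mod
    field %-≡ : x % K ≡ y % K

  ≈-setoid : Setoid 0ℓ 0ℓ
  ≈-setoid = record
    { Carrier       = ℕ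
    ; _≈_           = _≈_
    ; isEquivalence = record
      { refl  = mod refl
      ; sym   = λ (mod x≡y) → mod (sym x≡y)
      ; trans = λ (mod x≡y) (mod y≡z) → mod (trans x≡y y≡z)
      }
    }

  module ≈-Reasoning = SetoidReasoning ≈-setoid
  open Setoid ≈-setoid using () renaming (refl to ≈-refl)

  ≈-+ : ∀ {a b c d} → a ≈ b → c ≈ d → a + c ≈ b + d
  ≈-+ {a} {b} {c} {d} (mod a≈b) (mod c≈d) = mod (begin
    (a + c) % K           ≡⟨ %-distribˡ-+ a c K ⟩
    (a % K + c % K) % K   ≡⟨ cong₂ (λ s t → (s + t) % K) a≈b c≈d ⟩
    (b % K + d % K) % K   ≡⟨ %-distribˡ-+ b d K ⟨
    (b + d) % K           ∎)
    where open ≡-Reasoning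

  ≈-*ˡ : ∀ a {b c} → b ≈ c → a * b ≈ a * c
  ≈-*ˡ a {b} {c} (mod b≈c) = mod (begin
    (a * b) % K           ≡⟨ %-distribˡ-* a b K ⟩
    (a % K * (b % K)) % K ≡⟨ cong (λ t → (a % K * t) % K) b≈c ⟩
    (a % K * (c % K)) % K ≡⟨ %-distribˡ-* a c K ⟨
    (a * c) % K           ∎)
    where open ≡-Reasoning

  +-multiple : ∀ a b → a + b * K ≈ a
  +-multiple a b = mod ([m+kn]%n≡m%n a b K)

  -- Addition is cancellative, since a has the additive inverse k·a.
  +-cancelˡ-≈ : ∀ a {b c} → a + b ≈ a + c → b ≈ c
  +-cancelˡ-≈ a {b} {c} ab≈ac = begin
    b                  ≈⟨ +-multiple b a ⟨
    b + a * K          ≡⟨ shift b ⟩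
    k * a + (a + b)    ≈⟨ ≈-+ (≈-refl {k * a}) ab≈ac ⟩
    k * a + (a + c)    ≡⟨ shift c ⟨
    c + a * K          ≈⟨ +-multiple c a ⟩
    c                  ∎
    where
    open ≈-Reasoning
    shift : ∀ x → x + a * K ≡ k * a + (a + x)
    shift x = solve 3 (λ x a k → x :+ a :* (con 1 :+ k) := k :* a :+ (a :+ x)) refl x a k

  neg : ℕ → Fin K
  neg s = fromℕ< (m%n<n (k * s) K)

  +-neg : ∀ s → s + toℕ (neg s) ≈ 0
  +-neg s = begin
    s + toℕ (neg s)    ≡⟨ cong (s +_) (toℕ-fromℕ< (m%n<n (k * s) K)) ⟩
    s + (k * s) % K    ≈⟨ ≈-+ (≈-refl {s}) (mod (m%n%n≡m%n (k * s) K)) ⟩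
    s + k * s          ≡⟨ *-comm K s ⟩
    s * K              ≈⟨ mod (m*n%n≡0 s K) ⟩
    0                  ∎
    where open ≈-Reasoning

  ≈⇒≡ : ∀ {a b : Fin K} → toℕ a ≈ toℕ b → a ≡ b
  ≈⇒≡ {a} {b} (mod a≈b) =
    toℕ-injective (trans (sym (m<n⇒m%n≡m (toℕ<n a))) (trans a≈b (m<n⇒m%n≡m (toℕ<n b))))

-- For odd K = 2m + 1, doubling is invertible (with inverse m + 1); this
-- forbids the Pasch configuration in the cyclic design.
module OddModular (m : ℕ) where

  open Modular (2 * m)
  open ≈-Reasoning

  *2-cancel : ∀ {y z} → 2 * y ≈ 2 * z → y ≈ z
  *2-cancel {y} {z} 2y≈2z = begin
    y                  ≈⟨ +-multiple y y ⟨
    y + y * K          ≡⟨ halve y ⟩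
    suc m * (2 * y)    ≈⟨ ≈-*ˡ (suc m) 2y≈2z ⟩
    suc m * (2 * z)    ≡⟨ halve z ⟨
    z + z * K          ≈⟨ +-multiple z z ⟩
    z                  ∎
    where
    halve : ∀ x → x + x * K ≡ suc m * (2 * x)
    halve x = solve 2 (λ x m → x :+ x :* (con 1 :+ con 2 :* m) := (con 1 :+ m) :* (con 2 :* x)) refl x m

  -- The arithmetic core of Pasch-freeness: if the four Pasch blocks
  -- {1,2,3}, {3,4,5}, {1,5,6}, {2,4,6} have zero sum, then x₂ ≈ x₅,
  -- because the first and last sums add up to X + 2x₂, the middle ones to
  -- X + 2x₅ for the same X.
  pasch-residues : ∀ x₁ x₂ x₃ x₄ x₅ x₆ →
    x₁ + x₂ + x₃ ≈ 0 → x₃ + x₄ + x₅ ≈ 0 → x₁ + x₅ + x₆ ≈ 0 → x₂ + x₄ + x₆ ≈ 0 → x₂ ≈ x₅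
  pasch-residues x₁ x₂ x₃ x₄ x₅ x₆ s₁ s₂ s₃ s₄ = *2-cancel (+-cancelˡ-≈ X (begin
    X + 2 * x₂                               ≡⟨ regroup₂ ⟩
    (x₁ + x₂ + x₃) + (x₂ + x₄ + x₆)          ≈⟨ ≈-+ s₁ s₄ ⟩
    0                                        ≈⟨ ≈-+ s₂ s₃ ⟨
    (x₃ + x₄ + x₅) + (x₁ + x₅ + x₆)          ≡⟨ regroup₅ ⟨
    X + 2 * x₅                               ∎))
    where
    X = x₁ + x₃ + x₄ + x₆
    regroup₂ : X + 2 * x₂ ≡ (x₁ + x₂ + x₃) + (x₂ + x₄ + x₆)
    regroup₂ = solve 5 (λ a b c d f → a :+ c :+ d :+ f :+ con 2 :* b := (a :+ b :+ c) :+ (b :+ d :+ f))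
                 refl x₁ x₂ x₃ x₄ x₆
    regroup₅ : X + 2 * x₅ ≡ (x₃ + x₄ + x₅) + (x₁ + x₅ + x₆)
    regroup₅ = solve 5 (λ a c d e f → a :+ c :+ d :+ f :+ con 2 :* e := (c :+ d :+ e) :+ (a :+ e :+ f))
                 refl x₁ x₃ x₄ x₅ x₆

module CyclicTD (m : ℕ) where

  open Modular (2 * m)
  open OddModular m using (pasch-residues)

  -- The points Fin N correspond to pairs (group , position) in Fin 3 × Fin K.
  N : ℕ
  N = 3 * K

  group : Fin N → Fin 3
  group = quotient K

  pos : Fin N → Fin K
  pos = remainder {3} K

  point : Fin 3 → Fin K → Fin N
  point = combine

  group-point : ∀ i a → group (point i a) ≡ i
  group-point i a = cong proj₁ (remQuot-combine i a)

  pos-point : ∀ i a → pos (point i a) ≡ a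
  pos-point i a = cong proj₂ (remQuot-combine i a)

  point-ext : ∀ {x y} → group x ≡ group y → pos x ≡ pos y → x ≡ y
  point-ext {x} {y} gx≡gy px≡py = begin
    x                        ≡⟨ combine-remQuot {3} K x ⟨
    point (group x) (pos x)  ≡⟨ cong₂ point gx≡gy px≡py ⟩
    point (group y) (pos y)  ≡⟨ combine-remQuot {3} K y ⟩
    y                        ∎
    where open ≡-Reasoning

  point-≢ : ∀ i j a b → i ≢ j → point i a ≢ point j b
  point-≢ i j a b i≢j eq = i≢j (trans (sym (group-point i a)) (trans (cong group eq) (group-point j b)))

  -- A section chooses one position in every group; its line is the set of
  -- the three chosen points.  The blocks are the lines of zero-sum sections.
  Section : Set
  Section = Fin 3 → Fin K

  ZeroSum : Section → Set
  ZeroSum v = Σ3 (toℕ ∘ v) ≈ 0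

  chosen : Section → Fin 3 → Fin N
  chosen v i = point i (v i)

  line : Section → Subset N
  line v = tripleSet (chosen v zero , chosen v (suc zero) , chosen v (suc (suc zero)))

  IsLine : Subset N → Set
  IsLine B = Σ Section λ v → ZeroSum v × B ≡ line v

  line-cong : ∀ {v w : Section} → (∀ i → v i ≡ w i) → line v ≡ line w
  line-cong v≗w = cong₂ (λ a bc → tripleSet (point zero a , point (suc zero) (proj₁ bc) , point (suc (suc zero)) (proj₂ bc)))
                        (v≗w zero) (cong₂ _,_ (v≗w (suc zero)) (v≗w (suc (suc zero))))

  chosen-point : ∀ v i → pos (chosen v i) ≡ v (group (chosen v i))
  chosen-point v i = trans (pos-point i (v i)) (cong v (sym (group-point i (v i))))

  ∈-line⁻ : ∀ v {x} → x ∈ line v → pos x ≡ v (group x)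
  ∈-line⁻ v x∈ with ∈-tripleSet⁻ (chosen v zero) (chosen v (suc zero)) (chosen v (suc (suc zero))) x∈
  ... | inj₁ refl        = chosen-point v zero
  ... | inj₂ (inj₁ refl) = chosen-point v (suc zero)
  ... | inj₂ (inj₂ refl) = chosen-point v (suc (suc zero))

  chosen-∈-line : ∀ v i → chosen v i ∈ line v
  chosen-∈-line v zero             = ∈-triple₁ (chosen v zero) (chosen v (suc zero)) (chosen v (suc (suc zero)))
  chosen-∈-line v (suc zero)       = ∈-triple₂ (chosen v zero) (chosen v (suc zero)) (chosen v (suc (suc zero)))
  chosen-∈-line v (suc (suc zero)) = ∈-triple₃ (chosen v zero) (chosen v (suc zero)) (chosen v (suc (suc zero)))

  ∈-line⁺ : ∀ v {x} → pos x ≡ v (group x) → x ∈ line v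
  ∈-line⁺ v {x} px≡ = subst (_∈ line v) chosen≡x (chosen-∈-line v (group x))
    where
    chosen≡x : chosen v (group x) ≡ x
    chosen≡x = point-ext (group-point (group x) (v (group x))) (trans (pos-point (group x) (v (group x))) (sym px≡))

  -- Lines meet every group once, so they have three points.
  line-size : ∀ v → ∣ line v ∣ ≡ 3
  line-size v = ∣tripleSet∣ ( point-≢ zero (suc zero) (v zero) (v (suc zero)) (λ ())
                            , point-≢ zero (suc (suc zero)) (v zero) (v (suc (suc zero))) (λ ())
                            , point-≢ (suc zero) (suc (suc zero)) (v (suc zero)) (v (suc (suc zero))) (λ ()))

  line-transversal : ∀ v x y → x ∈ line v → y ∈ line v → x ≢ y → group x ≢ group y
  line-transversal v x y x∈ y∈ x≢y gx≡gy =
    x≢y (point-ext gx≡gy (trans (∈-line⁻ v x∈) (trans (cong v gx≡gy) (sym (∈-line⁻ v y∈)))))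

  -- The Latin-square property, uniqueness: two positions in distinct
  -- groups determine a zero-sum section, since the third position is
  -- determined by cancellation.
  sections-agree : ∀ {v w} → ZeroSum v → ZeroSum w → ∀ {i j} → i ≢ j →
                   v i ≡ w i → v j ≡ w j → ∀ t → v t ≡ w t
  sections-agree {v} {w} zv zw {i} {j} i≢j vi≡wi vj≡wj t with t ≟ᶠ i | t ≟ᶠ j
  ... | yes refl | _        = vi≡wi
  ... | no _     | yes refl = vj≡wj
  ... | no t≢i   | no t≢j   = ≈⇒≡ (+-cancelˡ-≈ (toℕ (v i) + toℕ (v j)) (begin
    toℕ (v i) + toℕ (v j) + toℕ (v t)   ≡⟨ sum-distinct (toℕ ∘ v) ijt ⟩
    Σ3 (toℕ ∘ v)                        ≈⟨ zv ⟩
    0                                   ≈⟨ zw ⟨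
    Σ3 (toℕ ∘ w)                        ≡⟨ sum-distinct (toℕ ∘ w) ijt ⟨
    toℕ (w i) + toℕ (w j) + toℕ (w t)   ≡⟨ cong₂ (λ a b → toℕ a + toℕ b + toℕ (w t)) vi≡wi vj≡wj ⟨
    toℕ (v i) + toℕ (v j) + toℕ (w t)   ∎))
    where
    open ≈-Reasoning
    ijt = i≢j , ≢-sym t≢i , ≢-sym t≢j

  -- The Latin-square property, existence: the section through positions a
  -- and b in the groups i ≢ j takes the position -(a + b) in the third group.
  section-through : ∀ {i j} → i ≢ j → ∀ a b → Σ Section λ v → ZeroSum v × v i ≡ a × v j ≡ b
  section-through {i} {j} i≢j a b = v , zero-sum , at-i , at-j
    where
    c : Fin K
    c = neg (toℕ a + toℕ b)
    v : Section
    v t with t ≟ᶠ i | t ≟ᶠ j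
    ... | yes _ | _     = a
    ... | no _  | yes _ = b
    ... | no _  | no _  = c
    at-i : v i ≡ a
    at-i with i ≟ᶠ i | i ≟ᶠ j
    ... | yes _  | _ = refl
    ... | no i≢i | _ = ⊥-elim (i≢i refl)
    at-j : v j ≡ b
    at-j with j ≟ᶠ i | j ≟ᶠ j
    ... | yes j≡i | _      = ⊥-elim (i≢j (sym j≡i))
    ... | no _    | yes _  = refl
    ... | no _    | no j≢j = ⊥-elim (j≢j refl)
    ijl = other-distinct i≢j
    at-other : v (other i j) ≡ c
    at-other with other i j ≟ᶠ i | other i j ≟ᶠ j
    ... | yes l≡i | _       = ⊥-elim (proj₁ (proj₂ ijl) (sym l≡i))
    ... | no _    | yes l≡j = ⊥-elim (proj₂ (proj₂ ijl) (sym l≡j))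
    ... | no _    | no _    = refl
    zero-sum : ZeroSum v
    zero-sum = begin
      Σ3 (toℕ ∘ v)                                  ≡⟨ sum-distinct (toℕ ∘ v) ijl ⟨
      toℕ (v i) + toℕ (v j) + toℕ (v (other i j))   ≡⟨ cong₂ _+_ (cong₂ _+_ (cong toℕ at-i) (cong toℕ at-j)) (cong toℕ at-other) ⟩
      toℕ a + toℕ b + toℕ c                         ≈⟨ +-neg (toℕ a + toℕ b) ⟩
      0                                             ∎
      where open ≈-Reasoning

  pair-on-unique-line : ∀ x y → group x ≢ group y →
    Σ (Subset N) λ B → (IsLine B × x ∈ B × y ∈ B) × (∀ B' → IsLine B' → x ∈ B' → y ∈ B' → B' ≡ B)
  pair-on-unique-line x y gx≢gy with section-through gx≢gy (pos x) (pos y)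
  ... | v , zv , vx≡ , vy≡ = line v , ((v , zv , refl) , ∈-line⁺ v (sym vx≡) , ∈-line⁺ v (sym vy≡)) , unique
    where
    unique : ∀ B' → IsLine B' → x ∈ B' → y ∈ B' → B' ≡ line v
    unique _ (w , zw , refl) x∈ y∈ = line-cong (sections-agree {w} {v} zw zv gx≢gy
      (trans (sym (∈-line⁻ w x∈)) (sym vx≡)) (trans (sym (∈-line⁻ w y∈)) (sym vy≡)))

  T : TripleSystem N
  T = record { Block = IsLine ; block-3 = λ { _ (v , _ , refl) → line-size v } }

  isTD : IsTD3 T group K
  isTD = record
    { group-size   = ∣run∣ 3 K
    ; transversal  = λ { _ (v , _ , refl) → line-transversal v }
    ; pair-covered = pair-on-unique-line
    }

  open TD3Facts isTD using (embedded-groups; pasch-same-group)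

  line-sum : ∀ {x y z} → IsLine (tripleSet (x , y , z)) → Distinct3 (group x) (group y) (group z) →
             toℕ (pos x) + toℕ (pos y) + toℕ (pos z) ≈ 0
  line-sum {x} {y} {z} (v , zv , eq) d = begin
    toℕ (pos x) + toℕ (pos y) + toℕ (pos z)                     ≡⟨ cong₂ _+_ (cong₂ _+_ (on x₁) (on x₂)) (on x₃) ⟩
    toℕ (v (group x)) + toℕ (v (group y)) + toℕ (v (group z))   ≡⟨ sum-distinct (toℕ ∘ v) d ⟩
    Σ3 (toℕ ∘ v)                                                ≈⟨ zv ⟩
    0                                                           ∎
    where
    open ≈-Reasoning
    on : ∀ {u} → u ∈ tripleSet (x , y , z) → toℕ (pos u) ≡ toℕ (v (group u))
    on u∈ = cong toℕ (∈-line⁻ v (subst (_ ∈_) eq u∈))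
    x₁ = ∈-triple₁ x y z
    x₂ = ∈-triple₂ x y z
    x₃ = ∈-triple₃ x y z

  -- Pasch-freeness: the points 2 and 5 of a Pasch configuration would share
  -- their group (as in every TD with three groups) and their position.
  Pasch-free : ¬ Contains T Pasch
  Pasch-free (f , f-inj , B₁ ∷ B₂ ∷ B₃ ∷ B₄ ∷ []) = q2≢q5 (f-inj (point-ext same-group same-pos))
    where
    q2≢q5 : q2 ≢ q5
    q2≢q5 ()
    x : Fin 6 → ℕ
    x i = toℕ (pos (f i))
    sum : ∀ {a b c} → IsLine (tripleSet (f a , f b , f c)) → Distinct3 a b c → x a + x b + x c ≈ 0
    sum B d = line-sum B (embedded-groups f-inj B d)
    same-group : group (f q2) ≡ group (f q5)
    same-group = pasch-same-group f-inj B₁ B₂ B₃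
    same-pos : pos (f q2) ≡ pos (f q5)
    same-pos = ≈⇒≡ (pasch-residues (x q1) (x q2) (x q3) (x q4) (x q5) (x q6)
      (sum B₁ ((λ ()) , (λ ()) , (λ ()))) (sum B₂ ((λ ()) , (λ ()) , (λ ())))
      (sum B₃ ((λ ()) , (λ ()) , (λ ()))) (sum B₄ ((λ ()) , (λ ()) , (λ ()))))

F3PaschFreeTD3 : ℕ → ℕ → Set₁
F3PaschFreeTD3 k n = Σ (TripleSystem n) λ T → Σ (Fin n → Fin 3) λ group →
  IsTD3 T group k × ¬ Contains T F3 × ¬ Contains T Pasch

cyclic-design : ∀ m → F3PaschFreeTD3 (suc (2 * m)) (3 * suc (2 * m))
cyclic-design m = T , group , isTD , TD3Facts.F3-free isTD , Pasch-free
  where open CyclicTD m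

lemma3p1 : (m : ℕ) →
    Σ (TripleSystem (6 * m + 3)) λ T →
      Σ (Fin (6 * m + 3) → Fin 3) λ group →
        IsTD3 T group (2 * m + 1) × ¬ Contains T F3 × ¬ Contains T Pasch
lemma3p1 m = subst₂ F3PaschFreeTD3 (+-comm 1 (2 * m)) point-count (cyclic-design m)
  where
  point-count : 3 * suc (2 * m) ≡ 6 * m + 3
  point-count = solve 1 (λ m → con 3 :* (con 1 :+ con 2 :* m) := con 6 :* m :+ con 3) refl m
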